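{- Let $G=(S\cup K,E)$ be a split graph without isolated vertices, where $S$ is an independent set and $K$ is a clique of $G$, and assume $K$ is a maximum clique, i.e. $\omega(G)=|K|$. Then $1\leq Tr_t(G)\leq\omega(G)-1$.
   Context: A total transitive partition of order $k$ of $G=(V,E)$ is a partition $\{V_1,\dots,V_k\}$ of $V$ into nonempty sets such that for all $1\leq i\leq j\leq k$, every vertex of $V_j$ has a neighbour in $V_i$ (for $i=j$: every vertex of $V_i$ is adjacent to another vertex of $V_i$). $Tr_t(G)$ is the maximum order of such a partition. $\omega(G)$ is the clique number of $G$. -}

module Defs where

open import Data.Nat using (ℕ; _≤_; _∸_)
open import Data.Fin using (Fin; toℕ)
open import Data.Fin.Subset using (Subset; _∈_; _∉_; ∣_∣)
open import Data.Bool using (Bool; T)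
open import Data.Product using (Σ; ∃; _×_)
open import Function using (Surjective)
open import Relation.Binary.PropositionalEquality using (_≡_; _≢_)
open import Relation.Nullary using (¬_)

record Graph (n : ℕ) : Set where
  field
    adj   : Fin n → Fin n → Bool
    sym   : ∀ u v → adj u v ≡ adj v u
    irrefl : ∀ v → adj v v ≡ Data.Bool.false

open Graph public

Adj : ∀ {n} → Graph n → Fin n → Fin n → Set
Adj G u v = T (adj G u v)

NoIsolatedVertices : ∀ {n} → Graph n → Set
NoIsolatedVertices {n} G = ∀ (v : Fin n) → ∃ λ u → Adj G v u

IsClique : ∀ {n} → Graph n → Subset n → Set
IsClique G C = ∀ u v → u ∈ C → v ∈ C → u ≢ v → Adj G u v

IsIndependentComplement : ∀ {n} → Graph n → Subset n → Set
IsIndependentComplement G K = ∀ u v → u ∉ K → v ∉ K → ¬ Adj G u v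

-- G is a split graph with clique K and independent set S = V ∖ K.
IsSplitPartition : ∀ {n} → Graph n → Subset n → Set
IsSplitPartition G K = IsClique G K × IsIndependentComplement G K

IsMaximumClique : ∀ {n} → Graph n → Subset n → Set
IsMaximumClique G K = IsClique G K × (∀ C → IsClique G C → ∣ C ∣ ≤ ∣ K ∣)

-- A total transitive partition of order k: f v is the (0-based) index of
-- the class of v; all classes nonempty (f surjective); for i ≤ j every
-- vertex of V_j has a neighbour in V_i (adjacency is irreflexive, so for
-- i = j the neighbour is another vertex of V_i).
IsTotalTransitivePartition : ∀ {n} → Graph n → (k : ℕ) → (Fin n → Fin k) → Set
IsTotalTransitivePartition {n} G k f =
  Surjective _≡_ _≡_ f ×
  (∀ (i : Fin k) (v : Fin n) → toℕ i ≤ toℕ (f v) →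
     ∃ λ u → f u ≡ i × Adj G v u)

HasTotalTransitivePartition : ∀ {n} → Graph n → ℕ → Set
HasTotalTransitivePartition {n} G k =
  Σ (Fin n → Fin k) (IsTotalTransitivePartition G k)

{-# OPTIONS --safe #-}
module Submission where

-- Write S = V ∖ K. Every neighbour of a vertex of S lies in K, so every class of
-- a total transitive partition of order k contains a vertex of K. Take c ∈ K in
-- the last class and a neighbour u of c in that class. Then u has a neighbour in
-- K in every class: if u ∈ S, any neighbour in the class will do; if u ∈ K, take
-- the vertex of K in that class, or c if that vertex is u itself. These k
-- neighbours lie in distinct classes, so with u they give k + 1 vertices of the
-- clique {u} ∪ (K ∩ N(u)). Hence k + 1 ≤ ω(G) = |K|. A single class gives a
-- partition of order 1, since there are no isolated vertices.

open import Defs hiding (sym)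
open import Data.Bool using (T)
open import Data.Bool.Properties using (T-≡)
open import Data.Empty using (⊥-elim)
open import Data.Fin using (Fin; zero; suc; toℕ; fromℕ; fromℕ<)
open import Data.Fin.Properties using (0≢1+n; suc-injective; ≤fromℕ) renaming (_≟_ to _≟ᶠ_)
open import Data.Fin.Subset using (Subset; ∣_∣; _∈_; _∉_; _∪_; _∩_; ⁅_⁆; _-_)
open import Data.Fin.Subset.Properties
  using (_∈?_; x∈⁅x⁆; x∈⁅y⁆⇒x≡y; x∈p∪q⁺; x∈p∪q⁻; x∈p∩q⁺; x∈p∩q⁻; x∈p∧x≢y⇒x∈p-y; x∈p⇒∣p-x∣<∣p∣)
open import Data.Nat using (zero; suc; _≤_; _<_; _∸_; z≤n; s≤s)
open import Data.Nat.Properties using (≤-trans; ≤-reflexive; ∸-monoˡ-≤)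
open import Data.Product using (∃; _×_; _,_; proj₁; proj₂)
import Data.Product as Product
open import Data.Sum using (_⊎_; inj₁; inj₂)
import Data.Sum as Sum
open import Data.Vec using (tabulate)
open import Data.Vec.Properties using (lookup∘tabulate; lookup⇒[]=; []=⇒lookup)
open import Function using (_∘_; Injective; Surjective; Equivalence)
open import Relation.Binary.PropositionalEquality using (_≡_; _≢_; refl; sym; trans; cong; subst)
open import Relation.Nullary using (yes; no)

injective⇒≤∣p∣ : ∀ {m n} {p : Subset n} (h : Fin m → Fin n) →
  Injective _≡_ _≡_ h → (∀ i → h i ∈ p) → m ≤ ∣ p ∣
injective⇒≤∣p∣ {zero} _ _ _ = z≤n
injective⇒≤∣p∣ {suc m} {p = p} h h-inj h∈p =
  ≤-trans (s≤s (injective⇒≤∣p∣ (h ∘ suc) (suc-injective ∘ h-inj) h∘suc∈p-h0))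
          (x∈p⇒∣p-x∣<∣p∣ (h∈p zero))
  where
  h∘suc∈p-h0 : ∀ i → h (suc i) ∈ p - h zero
  h∘suc∈p-h0 i = x∈p∧x≢y⇒x∈p-y (h∈p (suc i)) (0≢1+n ∘ sym ∘ h-inj)

module _ {n} {G : Graph n} where

  Neighbourhood : Fin n → Subset n
  Neighbourhood u = tabulate (adj G u)

  ∈-Neighbourhood⁺ : ∀ {u v} → Adj G u v → v ∈ Neighbourhood u
  ∈-Neighbourhood⁺ {u} {v} uv =
    lookup⇒[]= v _ (trans (lookup∘tabulate (adj G u) v) (Equivalence.to T-≡ uv))

  ∈-Neighbourhood⁻ : ∀ {u v} → v ∈ Neighbourhood u → Adj G u v
  ∈-Neighbourhood⁻ {u} {v} v∈N =
    Equivalence.from T-≡ (trans (sym (lookup∘tabulate (adj G u) v)) ([]=⇒lookup v∈N))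

  Adj-sym : ∀ {u v} → Adj G u v → Adj G v u
  Adj-sym {u} {v} = subst T (Graph.sym G u v)

  Adj⇒≢ : ∀ {u v} → Adj G u v → u ≢ v
  Adj⇒≢ {u} uu refl = subst T (irrefl G u) uu

  module _ {K : Subset n} where

    NeighbourClique : Fin n → Subset n
    NeighbourClique u = ⁅ u ⁆ ∪ (K ∩ Neighbourhood u)

    ∈-NeighbourClique⁻ : ∀ {u v} → v ∈ NeighbourClique u → v ≡ u ⊎ (v ∈ K × Adj G u v)
    ∈-NeighbourClique⁻ {u} =
      Sum.map (x∈⁅y⁆⇒x≡y u) (Product.map₂ ∈-Neighbourhood⁻ ∘ x∈p∩q⁻ K _) ∘ x∈p∪q⁻ ⁅ u ⁆ _

    NeighbourClique-isClique : IsClique G K → ∀ u → IsClique G (NeighbourClique u)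
    NeighbourClique-isClique K-clique u x y x∈ y∈ x≢y
      with ∈-NeighbourClique⁻ x∈ | ∈-NeighbourClique⁻ y∈
    ... | inj₁ refl       | inj₁ refl       = ⊥-elim (x≢y refl)
    ... | inj₁ refl       | inj₂ (_ , uy)   = uy
    ... | inj₂ (_ , ux)   | inj₁ refl       = Adj-sym ux
    ... | inj₂ (x∈K , _)  | inj₂ (y∈K , _)  = K-clique x y x∈K y∈K x≢y

    1+k≤∣NeighbourClique∣ : ∀ {k u} (w : Fin k → Fin n) → Injective _≡_ _≡_ w →
      (∀ i → w i ∈ K × Adj G u (w i)) → suc k ≤ ∣ NeighbourClique u ∣
    1+k≤∣NeighbourClique∣ {k} {u} w w-inj w-nbr = injective⇒≤∣p∣ h h-inj h∈
      where
      h : Fin (suc k) → Fin n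
      h zero    = u
      h (suc i) = w i

      h-inj : Injective _≡_ _≡_ h
      h-inj {zero}  {zero}  _   = refl
      h-inj {zero}  {suc j} u≡w = ⊥-elim (Adj⇒≢ (proj₂ (w-nbr j)) u≡w)
      h-inj {suc i} {zero}  w≡u = ⊥-elim (Adj⇒≢ (proj₂ (w-nbr i)) (sym w≡u))
      h-inj {suc i} {suc j} w≡w = cong suc (w-inj w≡w)

      h∈ : ∀ i → h i ∈ NeighbourClique u
      h∈ zero    = x∈p∪q⁺ (inj₁ (x∈⁅x⁆ u))
      h∈ (suc i) = x∈p∪q⁺ (inj₂ (x∈p∩q⁺ (Product.map₂ ∈-Neighbourhood⁺ (w-nbr i))))

module _ {n} {G : Graph n} {K : Subset n}
         (K-clique : IsClique G K) (S-independent : IsIndependentComplement G K) where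

  neighbour-of-S⇒∈K : ∀ {u w} → u ∉ K → Adj G u w → w ∈ K
  neighbour-of-S⇒∈K {u} {w} u∉K uw with w ∈? K
  ... | yes w∈K = w∈K
  ... | no  w∉K = ⊥-elim (S-independent u w u∉K w∉K uw)

  module _ {k} {f : Fin n → Fin k} (f-partition : IsTotalTransitivePartition G k f) where

    private
      f-surj : Surjective _≡_ _≡_ f
      f-surj = proj₁ f-partition

      f-total : ∀ i v → toℕ i ≤ toℕ (f v) → ∃ λ u → f u ≡ i × Adj G v u
      f-total = proj₂ f-partition

    KNeighbourIn : Fin n → Fin k → Set
    KNeighbourIn u i = ∃ λ w → w ∈ K × f w ≡ i × Adj G u w

    S-vertex-KNeighbourIn : ∀ {u i} → u ∉ K → toℕ i ≤ toℕ (f u) → KNeighbourIn u i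
    S-vertex-KNeighbourIn {u} {i} u∉K i≤fu =
      let w , fw≡i , uw = f-total i u i≤fu in w , neighbour-of-S⇒∈K u∉K uw , fw≡i , uw

    class-meets-K : ∀ i → ∃ λ c → c ∈ K × f c ≡ i
    class-meets-K i with f-surj i
    ... | r , fr≡i with r ∈? K
    ...   | yes r∈K = r , r∈K , fr≡i refl
    ...   | no  r∉K =
      let w , w∈K , fw≡i , _ =
            S-vertex-KNeighbourIn r∉K (≤-reflexive (cong toℕ (sym (fr≡i refl))))
      in w , w∈K , fw≡i

    KNeighbours-below : ∀ {c u} → c ∈ K → Adj G c u → f c ≡ f u →
      ∀ i → toℕ i ≤ toℕ (f u) → KNeighbourIn u i
    KNeighbours-below {c} {u} c∈K cu fc≡fu i i≤fu with u ∈? K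
    ... | no  u∉K = S-vertex-KNeighbourIn u∉K i≤fu
    ... | yes u∈K with class-meets-K i
    ...   | g , g∈K , fg≡i with g ≟ᶠ u
    ...     | no  g≢u  = g , g∈K , fg≡i , K-clique u g u∈K g∈K (g≢u ∘ sym)
    ...     | yes refl = c , c∈K , trans fc≡fu fg≡i , Adj-sym {G = G} cu

    class-has-vertex-with-KNeighbours-below :
      ∀ j → ∃ λ u → ∀ i → toℕ i ≤ toℕ j → KNeighbourIn u i
    class-has-vertex-with-KNeighbours-below j =
      let c , c∈K , fc≡j = class-meets-K j
          u , fu≡j , cu  = f-total j c (≤-reflexive (cong toℕ (sym fc≡j)))
      in u , λ i i≤j → KNeighbours-below c∈K cu (trans fc≡j (sym fu≡j)) i
                         (subst (λ x → toℕ i ≤ toℕ x) (sym fu≡j) i≤j)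

  order<∣K∣ : (∀ C → IsClique G C → ∣ C ∣ ≤ ∣ K ∣) →
    ∀ {k} → HasTotalTransitivePartition G (suc k) → suc k < ∣ K ∣
  order<∣K∣ K-maximum {k} (f , f-partition) =
    ≤-trans (1+k≤∣NeighbourClique∣ {G = G} {u = u} w w-inj w-nbr)
            (K-maximum _ (NeighbourClique-isClique {G = G} K-clique u))
    where
    top-vertex : ∃ λ u → ∀ i → toℕ i ≤ toℕ (fromℕ k) → KNeighbourIn f-partition u i
    top-vertex = class-has-vertex-with-KNeighbours-below f-partition (fromℕ k)

    u : Fin n
    u = proj₁ top-vertex

    KNeighbour : ∀ i → KNeighbourIn f-partition u i
    KNeighbour i = proj₂ top-vertex i (≤fromℕ i)

    w : Fin (suc k) → Fin n
    w = proj₁ ∘ KNeighbour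

    w-nbr : ∀ i → w i ∈ K × Adj G u (w i)
    w-nbr i = let _ , w∈K , _ , uw = KNeighbour i in w∈K , uw

    w-inj : Injective _≡_ _≡_ w
    w-inj {i} {j} wi≡wj =
      let _ , _ , fwi≡i , _ = KNeighbour i
          _ , _ , fwj≡j , _ = KNeighbour j
      in trans (sym fwi≡i) (trans (cong f wi≡wj) fwj≡j)

single-class-partition : ∀ {n} (G : Graph n) → NoIsolatedVertices G → Fin n →
  HasTotalTransitivePartition G 1
single-class-partition G no-isolated v = (λ _ → zero) , surj , total
  where
  surj : Surjective _≡_ _≡_ (λ (_ : Fin _) → zero)
  surj zero = v , λ _ → refl

  total : ∀ i u → toℕ i ≤ 0 → ∃ λ w → zero ≡ i × Adj G u w
  total zero u _ = let w , uw = no-isolated u in w , refl , uw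

lemma3 : ∀ {n} (G : Graph n) (K : Subset n) → 0 < n →
    IsSplitPartition G K → NoIsolatedVertices G → IsMaximumClique G K →
    (∃ λ k → 1 ≤ k × HasTotalTransitivePartition G k) ×
    (∀ k → HasTotalTransitivePartition G k → k ≤ ∣ K ∣ ∸ 1)
lemma3 G K 0<n (K-clique , S-independent) no-isolated (_ , K-maximum) =
  (1 , s≤s z≤n , single-class-partition G no-isolated (fromℕ< 0<n)) , order≤∣K∣∸1
  where
  order≤∣K∣∸1 : ∀ k → HasTotalTransitivePartition G k → k ≤ ∣ K ∣ ∸ 1
  order≤∣K∣∸1 zero    _ = z≤n
  order≤∣K∣∸1 (suc k) p = ∸-monoˡ-≤ 1 (order<∣K∣ {G = G} K-clique S-independent K-maximum p)
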